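{- There exists an integer $k_0$ such that the following holds. Let $\ell\ge1$ and let $\mathbf{T}$ be a collection of tournaments on a common vertex set with $|V(\mathbf{T})|\ge \ell+k_0$ and $|\mathbf{T}|\ge\ell+k_0$. Then $\mathbf{T}$ contains a near-rainbow $(P,2,50)$-broom for each $P\in\{\vec{P}_\ell,\overleftarrow{P}_\ell\}$.
   Context: $\vec{P}_\ell$ and $\overleftarrow{P}_\ell$ denote the directed paths of length $\ell$ ($\ell$ arcs) oriented forwards and backwards. For an oriented path $P=x_1\dots x_k$ ($k\ge2$) and integers $s_1,s_2$, a $(P,s_1,s_2)$-broom is obtained from $P$ by blowing up $x_1$ into $s_1$ vertices (start-tips) and $x_k$ into $s_2$ vertices (end-tips), all new arcs keeping the orientation of the corresponding arc of $P$; the arcs at start-tips/end-tips are start-tip-arcs/end-tip-arcs. For a collection $\mathbf{T}=\{T_c:c\in\Gamma\}$ of tournaments, a coloring of a broom $F$ with vertices in $V(\mathbf{T})$ is a map $\varphi:E(F)\to\Gamma$ with each arc $e$ in $T_{\varphi(e)}$; it is near-rainbow if all start-tip-arcs get the same color, all end-tip-arcs get the same color, and every path in $F$ from a start-tip to an end-tip receives pairwise distinct colors. $\mathbf{T}$ contains a near-rainbow broom if there is a copy of the broom with such a coloring. -}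

module Defs where

open import Data.Nat using (ℕ; zero; suc; _≡ᵇ_)
open import Data.Fin using (Fin; toℕ; inject₁) renaming (zero to fzero; suc to fsuc)
open import Data.Bool using (Bool; true; false; if_then_else_)
open import Data.Product using (Σ; ∃; _×_; _,_)
open import Data.Sum using (_⊎_)
open import Data.Empty using (⊥)
open import Relation.Binary.PropositionalEquality using (_≡_; _≢_)

record Tournament (n : ℕ) : Set₁ where
  field
    Arc     : Fin n → Fin n → Set
    irrefl  : ∀ u → Arc u u → ⊥
    total   : ∀ u v → u ≢ v → Arc u v ⊎ Arc v u
    asym    : ∀ u v → Arc u v → Arc v u → ⊥
open Tournament public

-- A collection of tournaments on the common vertex set Fin n, indexed by the
-- colour set Γ = Fin m (so |V(T)| = n and |T| = m).
Collection : ℕ → ℕ → Set₁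
Collection n m = Fin m → Tournament n

-- An oriented path P = x_0 … x_ℓ with ℓ arcs is given by an orientation
-- o : Fin ℓ → Bool; o i = true means the arc x_i → x_{i+1}, false means x_{i+1} → x_i.
Orientation : ℕ → Set
Orientation ℓ = Fin ℓ → Bool

forwardPath : (ℓ : ℕ) → Orientation ℓ
forwardPath ℓ _ = true

backwardPath : (ℓ : ℕ) → Orientation ℓ
backwardPath ℓ _ = false

-- Number of copies of the path vertex x_j in the (P,s1,s2)-broom:
-- x_0 is blown up into s1 start-tips, x_ℓ into s2 end-tips, the others stay single.
mult : (ℓ s₁ s₂ : ℕ) → Fin (suc ℓ) → ℕ
mult ℓ s₁ s₂ j =
  if toℕ j ≡ᵇ 0 then s₁ else (if toℕ j ≡ᵇ ℓ then s₂ else 1)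

BroomVertex : (ℓ s₁ s₂ : ℕ) → Set
BroomVertex ℓ s₁ s₂ = Σ (Fin (suc ℓ)) (λ j → Fin (mult ℓ s₁ s₂ j))

-- Arcs of the broom: for each arc i of P (between x_i and x_{i+1}) and each
-- copy a of x_i and b of x_{i+1}, one arc, oriented as the i-th arc of P.
BroomArc : (ℓ s₁ s₂ : ℕ) → Set
BroomArc ℓ s₁ s₂ =
  Σ (Fin ℓ) (λ i → Fin (mult ℓ s₁ s₂ (inject₁ i)) × Fin (mult ℓ s₁ s₂ (fsuc i)))

-- A path of the broom from a start-tip to an end-tip: a choice of one copy of
-- every path vertex x_j.
BroomPath : (ℓ s₁ s₂ : ℕ) → Set
BroomPath ℓ s₁ s₂ = (j : Fin (suc ℓ)) → Fin (mult ℓ s₁ s₂ j)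

pathArc : {ℓ s₁ s₂ : ℕ} → BroomPath ℓ s₁ s₂ → Fin ℓ → BroomArc ℓ s₁ s₂
pathArc σ i = i , σ (inject₁ i) , σ (fsuc i)

IsStartTipArc : {ℓ s₁ s₂ : ℕ} → BroomArc ℓ s₁ s₂ → Set
IsStartTipArc (i , _ , _) = toℕ i ≡ 0

IsEndTipArc : {ℓ s₁ s₂ : ℕ} → BroomArc ℓ s₁ s₂ → Set
IsEndTipArc {ℓ} (i , _ , _) = suc (toℕ i) ≡ ℓ

module _ {n ℓ s₁ s₂ : ℕ} (o : Orientation ℓ) (f : BroomVertex ℓ s₁ s₂ → Fin n) where
  tailOf : BroomArc ℓ s₁ s₂ → Fin n
  tailOf (i , a , b) = if o i then f (inject₁ i , a) else f (fsuc i , b)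

  headOf : BroomArc ℓ s₁ s₂ → Fin n
  headOf (i , a , b) = if o i then f (fsuc i , b) else f (inject₁ i , a)

ContainsNearRainbowBroom : {n m : ℕ} → Collection n m →
                           (ℓ : ℕ) → Orientation ℓ → (s₁ s₂ : ℕ) → Set
ContainsNearRainbowBroom {n} {m} T ℓ o s₁ s₂ =
  Σ (BroomVertex ℓ s₁ s₂ → Fin n) λ f →
  Σ (BroomArc ℓ s₁ s₂ → Fin m) λ φ →
    (∀ x y → f x ≡ f y → x ≡ y)
  × (∀ e → Arc (T (φ e)) (tailOf o f e) (headOf o f e))
  × (∀ e e′ → IsStartTipArc e → IsStartTipArc e′ → φ e ≡ φ e′)
  × (∀ e e′ → IsEndTipArc e → IsEndTipArc e′ → φ e ≡ φ e′)
  × (∀ (σ : BroomPath ℓ s₁ s₂) (i j : Fin ℓ) →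
       φ (pathArc σ i) ≡ φ (pathArc σ j) → i ≡ j)

-- The broom is grown one arc at a time using two colours c₁, c₂ it does not use yet. Among the
-- unused vertices r, either many have r ⟶ first in c₁, and an in-star in c₂ among them supplies
-- new start tips; or many have last ⟶ r in c₁ (resp. c₂), and an out-star in c₂ (resp. c₁)
-- among them supplies a new last vertex with its end tips; or, by counting, some r has
-- first ⟶ r in c₁ and r ⟶ last in both colours, and then r can be spliced into the path,
-- trading one of its colours for c₁ and c₂. Every tournament on starBound k vertices contains an
-- out-star with k leaves, which bounds the number of vertices needed. Backward brooms are forward
-- brooms of the reversed tournaments.
{-# OPTIONS --safe #-}
module Submission where

open import Level using (Level)
open import Data.Nat using (ℕ; zero; suc; _+_; _≤_; _<_; z≤n; s≤s; _≤?_; _≡ᵇ_)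
open import Data.Nat.Properties
open import Algebra.Properties.CommutativeSemigroup +-commutativeSemigroup using (x∙yz≈y∙xz)
open import Data.Fin using (Fin; toℕ; inject₁; fromℕ<) renaming (_≟_ to _≟ᶠ_; suc to fsuc)
open import Data.Fin.Properties using (toℕ-injective; toℕ<n; toℕ-inject₁)
open import Data.Bool using (Bool; true; false; if_then_else_) renaming (T to True)
open import Data.Unit using (tt)
open import Data.Product using (∃; ∃₂; _×_; _,_; proj₁; proj₂)
open import Data.Sum using (inj₁; inj₂) renaming (swap to ⊎-swap)
open import Function using (_∘_)
open import Defs
open import Data.Empty using (⊥-elim)
open import Data.List using (List; []; _∷_; [_]; _++_; length; filter; take; allFin)
open import Data.List.Properties using (length-++; ++-assoc; length-take; length-tabulate)
open import Data.List.Relation.Unary.All as All using (All; []; _∷_)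
open import Data.List.Relation.Unary.All.Properties using (¬Any⇒All¬; take⁺; all-filter; ++⁻ˡ)
open import Data.List.Relation.Unary.Any using (here; there)
open import Data.List.Relation.Unary.Unique.Propositional using (Unique; []; _∷_)
import Data.List.Relation.Unary.Unique.Propositional.Properties as Unique
open import Data.List.Membership.Propositional using (_∈_; _∉_)
open import Data.List.Membership.Propositional.Properties using (∈-∃++; ∈-filter⁻; ∈-++⁺ˡ; ∈-++⁺ʳ)
open import Data.List.Relation.Binary.Disjoint.Propositional using (Disjoint)
open import Data.List.Relation.Binary.Subset.Propositional using (_⊆_)
open import Data.List.Relation.Binary.Subset.Propositional.Properties using (filter-⊆)
import Data.List.Relation.Binary.Sublist.Setoid.Properties as SublistProperties
import Data.List.Relation.Binary.Sublist.Propositional.Properties as Sublist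
open import Data.List.Relation.Binary.Permutation.Propositional
  using (_↭_; ↭⇒↭ₛ; ↭-sym; refl; prep; swap; trans)
open import Data.List.Relation.Binary.Permutation.Propositional.Properties
  using (shift; shifts; ↭-length; ∈-resp-↭; ++⁺ˡ; ++⁺ʳ; ++-comm)
import Data.List.Relation.Binary.Permutation.Setoid.Properties as Permutationₛ
open import Relation.Nullary using (¬_; Dec; yes; no)
open import Relation.Unary using (Pred; Decidable)
open import Relation.Unary.Properties using (∁?)
open import Relation.Binary.PropositionalEquality as ≡
  using (_≡_; _≢_; ≢-sym; refl; sym; cong; cong₂; subst; setoid; module ≡-Reasoning)

private variable
  a p : Level

module _ {A : Set a} where

  Unique-resp-↭ : {xs ys : List A} → xs ↭ ys → Unique xs → Unique ys
  Unique-resp-↭ xs↭ys = Permutationₛ.Unique-resp-↭ (setoid A) (↭⇒↭ₛ xs↭ys)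

  Unique-∷ : {x : A} {xs : List A} → x ∉ xs → Unique xs → Unique (x ∷ xs)
  Unique-∷ {xs = xs} x∉xs xs! = ¬Any⇒All¬ xs x∉xs ∷ xs!

  Unique-⊆⇒length≤ : {xs ys : List A} → Unique xs → xs ⊆ ys → length xs ≤ length ys
  Unique-⊆⇒length≤ {[]}     _           _     = z≤n
  Unique-⊆⇒length≤ {x ∷ xs} (x≢xs ∷ xs!) xs⊆ys with ∈-∃++ (xs⊆ys (here refl))
  ... | us , vs , refl = begin
    suc (length xs)          ≤⟨ s≤s (Unique-⊆⇒length≤ xs! xs⊆us++vs) ⟩
    suc (length (us ++ vs))  ≡⟨ ↭-length (shift x us vs) ⟨
    length (us ++ x ∷ vs)    ∎
    where
    open ≤-Reasoning
    xs⊆us++vs : xs ⊆ us ++ vs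
    xs⊆us++vs y∈xs with ∈-resp-↭ (shift x us vs) (xs⊆ys (there y∈xs))
    ... | here y≡x  = ⊥-elim (All.lookup x≢xs y∈xs (sym y≡x))
    ... | there y∈ = y∈

  Unique-++⁻ˡ : ∀ (xs : List A) {ys} → Unique (xs ++ ys) → Unique xs
  Unique-++⁻ˡ []       _           = []
  Unique-++⁻ˡ (x ∷ xs) (x≢ ∷ xs!) = ++⁻ˡ xs x≢ ∷ Unique-++⁻ˡ xs xs!

  Unique-++⁻ʳ : ∀ (xs : List A) {ys} → Unique (xs ++ ys) → Unique ys
  Unique-++⁻ʳ []       ys!       = ys!
  Unique-++⁻ʳ (x ∷ xs) (_ ∷ xs!) = Unique-++⁻ʳ xs xs!

  Unique-exchange : ∀ {x y d : A} {xs ys zs} → x ≢ y → x ∉ xs → y ∉ xs →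
                    xs ↭ d ∷ zs → ys ↭ x ∷ y ∷ zs → Unique xs → Unique ys
  Unique-exchange {x} {y} {zs = zs} x≢y x∉xs y∉xs xs↭ ys↭ xs! with Unique-resp-↭ xs↭ xs!
  ... | _ ∷ zs! = Unique-resp-↭ (↭-sym ys↭) (Unique-∷ x∉y∷zs (Unique-∷ (y∉xs ∘ zs⊆xs) zs!))
    where
    zs⊆xs : zs ⊆ _
    zs⊆xs = ∈-resp-↭ (↭-sym xs↭) ∘ there
    x∉y∷zs : x ∉ y ∷ zs
    x∉y∷zs (here x≡y)   = x≢y x≡y
    x∉y∷zs (there x∈zs) = x∉xs (zs⊆xs x∈zs)

  distinctPair : ∀ {xs : List A} → Unique xs → 2 ≤ length xs → ∃₂ λ x y → x ∈ xs × y ∈ xs × x ≢ y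
  distinctPair {x ∷ y ∷ _} ((x≢y ∷ _) ∷ _) _         = x , y , here refl , there (here refl) , x≢y
  distinctPair {x ∷ []}    _                 (s≤s ())

  0<length⇒∃∈ : ∀ (xs : List A) → 0 < length xs → ∃ (_∈ xs)
  0<length⇒∃∈ (x ∷ _) _ = x , here refl

  length-∷ʳ : ∀ (xs : List A) {x} → length (xs ++ [ x ]) ≡ suc (length xs)
  length-∷ʳ xs = ≡.trans (length-++ xs) (+-comm _ 1)

  ∈∧∉⇒≢ : ∀ {x y : A} {xs} → x ∈ xs → y ∉ xs → x ≢ y
  ∈∧∉⇒≢ x∈xs y∉xs x≡y = y∉xs (subst (_∈ _) x≡y x∈xs)

  length-filter-∁ : {P : Pred A p} (P? : Decidable P) (xs : List A) →
                    length (filter P? xs) + length (filter (∁? P?) xs) ≡ length xs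
  length-filter-∁ P? []       = refl
  length-filter-∁ P? (x ∷ xs) with P? x
  ... | yes _ = cong suc (length-filter-∁ P? xs)
  ... | no  _ = ≡.trans (+-suc _ _) (cong suc (length-filter-∁ P? xs))

  take-⊆ : ∀ k (xs : List A) → take k xs ⊆ xs
  take-⊆ k xs = Sublist.Any-resp-⊆ (SublistProperties.take-⊆ (setoid A) k xs)

  -- The default is a junk value; below it is only ever consulted at in-range positions.
  lookupOr : A → List A → ℕ → A
  lookupOr d []       _       = d
  lookupOr d (x ∷ xs) zero    = x
  lookupOr d (x ∷ xs) (suc i) = lookupOr d xs i

  lookupOr-∈ : ∀ {d} (xs : List A) {i} → i < length xs → lookupOr d xs i ∈ xs
  lookupOr-∈ (x ∷ xs) {zero}  _         = here refl
  lookupOr-∈ (x ∷ xs) {suc i} (s≤s i<n) = there (lookupOr-∈ xs i<n)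

  lookupOr-injective : ∀ {d} {xs : List A} {i j} → Unique xs → i < length xs → j < length xs →
                       lookupOr d xs i ≡ lookupOr d xs j → i ≡ j
  lookupOr-injective {i = zero}  {zero}  _            _         _         _  = refl
  lookupOr-injective {xs = x ∷ xs} {zero}  {suc j} (x≢xs ∷ _) _ (s≤s j<n) eq =
    ⊥-elim (All.lookup x≢xs (lookupOr-∈ xs j<n) eq)
  lookupOr-injective {xs = x ∷ xs} {suc i} {zero}  (x≢xs ∷ _) (s≤s i<n) _ eq =
    ⊥-elim (All.lookup x≢xs (lookupOr-∈ xs i<n) (sym eq))
  lookupOr-injective {xs = x ∷ xs} {suc i} {suc j} (_ ∷ xs!) (s≤s i<n) (s≤s j<n) eq =
    cong suc (lookupOr-injective xs! i<n j<n eq)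

  lookupOr-++ˡ : ∀ {d} (xs : List A) {ys i} → i < length xs → lookupOr d (xs ++ ys) i ≡ lookupOr d xs i
  lookupOr-++ˡ (x ∷ xs) {i = zero}  _         = refl
  lookupOr-++ˡ (x ∷ xs) {i = suc i} (s≤s i<n) = lookupOr-++ˡ xs i<n

  lookupOr-++ʳ : ∀ {d} (xs : List A) {ys s} k → length xs ≡ s →
                 lookupOr d (xs ++ ys) (s + k) ≡ lookupOr d ys k
  lookupOr-++ʳ []       k refl = refl
  lookupOr-++ʳ (x ∷ xs) k refl = lookupOr-++ʳ xs k refl

module _ {n : ℕ} where

  open import Data.List.Membership.DecPropositional (_≟ᶠ_ {n}) using (_∈?_)

  outside : List (Fin n) → List (Fin n)
  outside U = filter (∁? (_∈? U)) (allFin n)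

  outside-unique : (U : List (Fin n)) → Unique (outside U)
  outside-unique U = Unique.filter⁺ (∁? (_∈? U)) (Unique.allFin⁺ n)

  ∈-outside⁻ : (U : List (Fin n)) {x : Fin n} → x ∈ outside U → x ∉ U
  ∈-outside⁻ U x∈ = proj₂ (∈-filter⁻ (∁? (_∈? U)) {xs = allFin n} x∈)

  outside-length-≥ : (U : List (Fin n)) {k : ℕ} → k + length U ≤ n → k ≤ length (outside U)
  outside-length-≥ U {k} k+U≤n = +-cancelʳ-≤ (length U) k (length (outside U)) (begin
    k + length U                         ≤⟨ k+U≤n ⟩
    n                                    ≡⟨ length-tabulate (λ x → x) ⟨
    length (allFin n)                    ≡⟨ length-filter-∁ (_∈? U) (allFin n) ⟨
    length inside + length (outside U)   ≤⟨ +-monoˡ-≤ _ inside≤U ⟩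
    length U + length (outside U)        ≡⟨ +-comm (length U) _ ⟩
    length (outside U) + length U        ∎)
    where
    open ≤-Reasoning
    inside = filter (_∈? U) (allFin n)
    inside≤U : length inside ≤ length U
    inside≤U = Unique-⊆⇒length≤ (Unique.filter⁺ (_∈? U) (Unique.allFin⁺ n))
                                 (λ x∈ → proj₂ (∈-filter⁻ (_∈? U) {xs = allFin n} x∈))

module _ {n : ℕ} (τ : Tournament n) where

  Arc? : ∀ u v → Dec (Arc τ u v)
  Arc? u v with u ≟ᶠ v
  ... | yes refl = no (irrefl τ u)
  ... | no u≢v with total τ u v u≢v
  ...   | inj₁ uv = yes uv
  ...   | inj₂ vu = no (λ uv → asym τ u v uv vu)

  Arc⇒≢ : ∀ {u v} → Arc τ u v → u ≢ v
  Arc⇒≢ {u} uv refl = irrefl τ u uv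

  ¬Arc⇒Arc : ∀ {u v} → u ≢ v → ¬ Arc τ v u → Arc τ u v
  ¬Arc⇒Arc {u} {v} u≢v ¬vu with total τ u v u≢v
  ... | inj₁ uv = uv
  ... | inj₂ vu = ⊥-elim (¬vu vu)

  source∉targets : ∀ {v xs} → All (Arc τ v) xs → v ∉ xs
  source∉targets v⟶xs v∈xs = Arc⇒≢ (All.lookup v⟶xs v∈xs) refl

reverse : ∀ {n} → Tournament n → Tournament n
reverse τ = record
  { Arc    = λ u v → Arc τ v u
  ; irrefl = irrefl τ
  ; total  = λ u v u≢v → ⊎-swap (total τ u v u≢v)
  ; asym   = λ u v vu uv → asym τ v u vu uv
  }

starBound : ℕ → ℕ
starBound zero    = 1
starBound (suc k) = suc (k + starBound k)

bicliqueBound : ℕ → ℕ → ℕ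
bicliqueBound zero    k = k
bicliqueBound (suc s) k = starBound (bicliqueBound s k)

0<starBound : ∀ k → 0 < starBound k
0<starBound zero    = s≤s z≤n
0<starBound (suc k) = s≤s z≤n

starBound-mono : ∀ {k k′} → k ≤ k′ → starBound k ≤ starBound k′
starBound-mono {k′ = k′}  z≤n        = 0<starBound k′
starBound-mono (s≤s k≤k′) = s≤s (+-mono-≤ k≤k′ (starBound-mono k≤k′))

k≤starBound : ∀ k → k ≤ starBound k
k≤starBound zero    = z≤n
k≤starBound (suc k) = s≤s (m≤m+n k (starBound k))

bicliqueBound-monoʳ : ∀ s {k k′} → k ≤ k′ → bicliqueBound s k ≤ bicliqueBound s k′
bicliqueBound-monoʳ zero    k≤k′ = k≤k′
bicliqueBound-monoʳ (suc s) k≤k′ = starBound-mono (bicliqueBound-monoʳ s k≤k′)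

module _ {n : ℕ} (τ : Tournament n) where

  record OutStar (k : ℕ) (L : List (Fin n)) : Set where
    field
      centre        : Fin n
      centre∈       : centre ∈ L
      leaves        : List (Fin n)
      leaves⊆       : leaves ⊆ L
      leaves-unique : Unique leaves
      leaves-length : length leaves ≡ k
      centre⟶leaves : All (Arc τ centre) leaves

  -- Either the first vertex v has k + 1 out-neighbours, or a star of size k among
  -- its in-neighbours extends by v.
  outStar : ∀ k (L : List (Fin n)) → Unique L → starBound k ≤ length L → OutStar k L
  outStar zero (v ∷ _) _ _ = record
    { centre = v ; centre∈ = here refl ; leaves = [] ; leaves⊆ = λ ()
    ; leaves-unique = [] ; leaves-length = refl ; centre⟶leaves = [] }
  outStar (suc k) (v ∷ L) (v≢L ∷ L!) (s≤s k+bound≤L) with suc k ≤? length (filter (Arc? τ v) L)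
  ... | yes k<Out = record
    { centre        = v
    ; centre∈       = here refl
    ; leaves        = take (suc k) Out
    ; leaves⊆       = there ∘ filter-⊆ (Arc? τ v) L ∘ take-⊆ (suc k) Out
    ; leaves-unique = Unique.take⁺ (suc k) (Unique.filter⁺ (Arc? τ v) L!)
    ; leaves-length = ≡.trans (length-take (suc k) Out) (m≤n⇒m⊓n≡m k<Out)
    ; centre⟶leaves = take⁺ (suc k) (all-filter (Arc? τ v) L)
    }
    where Out = filter (Arc? τ v) L
  ... | no k≮Out = record
    { centre        = centre
    ; centre∈       = there (In⊆L centre∈)
    ; leaves        = v ∷ leaves
    ; leaves⊆       = λ { (here refl) → here refl ; (there x∈) → there (In⊆L (leaves⊆ x∈)) }
    ; leaves-unique = Unique-∷ (λ v∈ → All.lookup v≢L (In⊆L (leaves⊆ v∈)) refl) leaves-unique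
    ; leaves-length = cong suc leaves-length
    ; centre⟶leaves = centre⟶v ∷ centre⟶leaves
    }
    where
    In = filter (∁? (Arc? τ v)) L
    In⊆L : In ⊆ L
    In⊆L = filter-⊆ (∁? (Arc? τ v)) L
    In-large : starBound k ≤ length In
    In-large = +-cancelˡ-≤ k (starBound k) (length In) (begin
      k + starBound k                              ≤⟨ k+bound≤L ⟩
      length L                                     ≡⟨ length-filter-∁ (Arc? τ v) L ⟨
      length (filter (Arc? τ v) L) + length In     ≤⟨ +-monoˡ-≤ (length In) (≤-pred (≰⇒> k≮Out)) ⟩
      k + length In                                ∎)
      where open ≤-Reasoning
    open OutStar (outStar k In (Unique.filter⁺ (∁? (Arc? τ v)) L!) In-large)
    centre⟶v : Arc τ centre v
    centre⟶v with ∈-filter⁻ (∁? (Arc? τ v)) {xs = L} centre∈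
    ... | centre∈L , v↛centre = ¬Arc⇒Arc τ (∈∧∉⇒≢ centre∈L v∉L) v↛centre
      where
      v∉L : v ∉ L
      v∉L v∈L = All.lookup v≢L v∈L refl

  record OutBiclique (s k : ℕ) (L : List (Fin n)) : Set where
    field
      sources         : List (Fin n)
      targets         : List (Fin n)
      sources⊆        : sources ⊆ L
      targets⊆        : targets ⊆ L
      sources-unique  : Unique sources
      targets-unique  : Unique targets
      sources-length  : length sources ≡ s
      targets-length  : length targets ≡ k
      sources⟶targets : All (λ u → All (Arc τ u) targets) sources

  outBiclique : ∀ s k (L : List (Fin n)) → Unique L → bicliqueBound s k ≤ length L → OutBiclique s k L
  outBiclique zero k L L! k≤L = record
    { sources = [] ; targets = take k L ; sources⊆ = λ () ; targets⊆ = take-⊆ k L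
    ; sources-unique = [] ; targets-unique = Unique.take⁺ k L!
    ; sources-length = refl ; targets-length = ≡.trans (length-take k L) (m≤n⇒m⊓n≡m k≤L)
    ; sources⟶targets = [] }
  outBiclique (suc s) k L L! bound≤L = record
    { sources         = centre ∷ sources
    ; targets         = targets
    ; sources⊆        = λ { (here refl) → centre∈ ; (there x∈) → leaves⊆ (sources⊆ x∈) }
    ; targets⊆        = leaves⊆ ∘ targets⊆
    ; sources-unique  = Unique-∷ (source∉targets τ centre⟶leaves ∘ sources⊆) sources-unique
    ; targets-unique  = targets-unique
    ; sources-length  = cong suc sources-length
    ; targets-length  = targets-length
    ; sources⟶targets = All.tabulate (All.lookup centre⟶leaves ∘ targets⊆) ∷ sources⟶targets
    }
    where
    open OutStar (outStar (bicliqueBound s k) L L! bound≤L)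
    open OutBiclique (outBiclique s k leaves leaves-unique (≤-reflexive (sym leaves-length)))

module _ {n m : ℕ} (T : Collection n m) where

  subst-Arc : ∀ {c c′ u u′ v v′} → c ≡ c′ → u ≡ u′ → v ≡ v′ → Arc (T c) u v → Arc (T c′) u′ v′
  subst-Arc refl refl refl u⟶v = u⟶v

  data Path : Fin n → Fin n → List (Fin n) → List (Fin m) → Set where
    nil  : ∀ {a} → Path a a [ a ] []
    cons : ∀ {a y b vs cs} c → Arc (T c) a y → Path y b vs cs → Path a b (a ∷ vs) (c ∷ cs)

  Path-first∈ : ∀ {a b vs cs} → Path a b vs cs → a ∈ vs
  Path-first∈ nil          = here refl
  Path-first∈ (cons _ _ _) = here refl

  Path-last∈ : ∀ {a b vs cs} → Path a b vs cs → b ∈ vs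
  Path-last∈ nil          = here refl
  Path-last∈ (cons _ _ p) = there (Path-last∈ p)

  Path-length : ∀ {a b vs cs} → Path a b vs cs → length vs ≡ suc (length cs)
  Path-length nil          = refl
  Path-length (cons _ _ p) = cong suc (Path-length p)

  Path-head : ∀ {a b vs cs} d → Path a b vs cs → lookupOr d vs 0 ≡ a
  Path-head d nil          = refl
  Path-head d (cons _ _ _) = refl

  Path-last : ∀ {a b vs cs} d → Path a b vs cs → lookupOr d vs (length cs) ≡ b
  Path-last d nil          = refl
  Path-last d (cons _ _ p) = Path-last d p

  Path-arc : ∀ {a b vs cs} d c → Path a b vs cs → ∀ {i} → i < length cs →
             Arc (T (lookupOr c cs i)) (lookupOr d vs i) (lookupOr d vs (suc i))
  Path-arc d _ (cons c a⟶y p) {zero}  _         = subst (Arc (T c) _) (sym (Path-head d p)) a⟶y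
  Path-arc d c (cons _ _ p)   {suc i} (s≤s i<n) = Path-arc d c p i<n

  Path-snoc : ∀ {a b vs cs c w} → Path a b vs cs → Arc (T c) b w → Path a w (vs ++ [ w ]) (cs ++ [ c ])
  Path-snoc {c = c} nil b⟶w = cons c b⟶w nil
  Path-snoc (cons c a⟶y p) b⟶w = cons c a⟶y (Path-snoc p b⟶w)

  record Splice (c₁ c₂ : Fin m) (v a b : Fin n) (vs : List (Fin n)) (cs : List (Fin m)) : Set where
    field
      vertices  : List (Fin n)
      colours   : List (Fin m)
      dropped   : Fin m
      kept      : List (Fin m)
      path      : Path a b vertices colours
      vertices↭ : vertices ↭ v ∷ vs
      cs↭       : cs ↭ dropped ∷ kept
      colours↭  : colours ↭ c₁ ∷ c₂ ∷ kept

  -- Walking along the path, v is entered from the current vertex in colour c₁. Either v leaves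
  -- to the next vertex in c₂, and v is spliced in there, or the next vertex enters v in c₂ and
  -- the walk continues with c₁ and c₂ swapped. It cannot reach b, since v ⟶ b in both colours.
  splice : ∀ {c₁ c₂ v a b vs cs} → Path a b vs cs → v ∉ vs →
           Arc (T c₁) a v → Arc (T c₁) v b → Arc (T c₂) v b → Splice c₁ c₂ v a b vs cs
  splice {c₁} {a = a} nil _ a⟶v v⟶a _ = ⊥-elim (asym (T c₁) a _ a⟶v v⟶a)
  splice {c₁} {c₂} {v} (cons {a} {y} {vs = vs} {cs} c a⟶y p) v∉ a⟶v v⟶b₁ v⟶b₂ with Arc? (T c₂) v y
  ... | yes v⟶y = record
    { vertices = a ∷ v ∷ vs ; colours = c₁ ∷ c₂ ∷ cs ; dropped = c ; kept = cs
    ; path = cons c₁ a⟶v (cons c₂ v⟶y p)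
    ; vertices↭ = swap a v refl ; cs↭ = refl ; colours↭ = refl }
  ... | no v↛y = record
    { vertices  = a ∷ vertices
    ; colours   = c ∷ colours
    ; dropped   = dropped
    ; kept      = c ∷ kept
    ; path      = cons c a⟶y path
    ; vertices↭ = trans (prep a vertices↭) (swap a v refl)
    ; cs↭       = trans (prep c cs↭) (swap c dropped refl)
    ; colours↭  = trans (prep c colours↭)
                    (trans (swap c c₂ refl) (trans (prep c₂ (swap c c₁ refl)) (swap c₂ c₁ refl)))
    }
    where
    y⟶v : Arc (T c₂) y v
    y⟶v = ¬Arc⇒Arc (T c₂) (λ y≡v → v∉ (there (subst (_∈ vs) y≡v (Path-first∈ p)))) v↛y
    open Splice (splice p (v∉ ∘ there) y⟶v v⟶b₂ v⟶b₁)

module Layout (s₁ s₂ : ℕ) where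

  -- Defs.mult ℓ s₁ s₂ j reduces to width ℓ (toℕ j).
  width : ℕ → ℕ → ℕ
  width ℓ i = if i ≡ᵇ 0 then s₁ else (if i ≡ᵇ ℓ then s₂ else 1)

  -- A broom with suc t arcs is stored as the list starts ++ inner vertices ++ ends, with copy k
  -- of x_i at position slot i k; Layer t i k says that this copy exists.
  slot : ℕ → ℕ → ℕ
  slot zero    k = k
  slot (suc j) k = s₁ + (j + k)

  data Layer (t : ℕ) : ℕ → ℕ → Set where
    start : ∀ {k} → k < s₁ → Layer t zero k
    inner : ∀ {j} → j < t → Layer t (suc j) zero
    end   : ∀ {k} → k < s₂ → Layer t (suc t) k

  layer : ∀ {t i k} → i ≤ suc t → k < width (suc t) i → Layer t i k
  layer {i = zero} _ k<s₁ = start k<s₁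
  layer {t} {suc j} (s≤s j≤t) k< with j ≡ᵇ t in j≡ᵇt
  layer {t} {suc j} (s≤s j≤t) k< | true with refl ← ≡ᵇ⇒≡ j t (subst True (sym j≡ᵇt) tt) = end k<
  layer {t} {suc j} (s≤s j≤t) (s≤s z≤n) | false =
    inner (≤∧≢⇒< j≤t (λ j≡t → subst True j≡ᵇt (≡⇒≡ᵇ j t j≡t)))

  private
    <⇒≢+ : ∀ {x y z} → x < y → x ≢ y + z
    <⇒≢+ x<y = <⇒≢ (<-≤-trans x<y (m≤m+n _ _))

    j+0<t : ∀ {j t} → j < t → j + 0 < t
    j+0<t {j} = subst (_< _) (sym (+-identityʳ j))

  slot-< : ∀ {t i k} → Layer t i k → slot i k < s₁ + (t + s₂)
  slot-< {t} (start k<s₁)      = <-≤-trans k<s₁ (m≤m+n s₁ (t + s₂))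
  slot-< {t} (inner j<t)       = +-monoʳ-< s₁ (<-≤-trans (j+0<t j<t) (m≤m+n t s₂))
  slot-< {t} (end k<s₂)        = +-monoʳ-< s₁ (+-monoʳ-< t k<s₂)

  slot-injective : ∀ {t i k i′ k′} → Layer t i k → Layer t i′ k′ →
                   slot i k ≡ slot i′ k′ → i ≡ i′ × k ≡ k′
  slot-injective (start _)     (start _)      eq = refl , eq
  slot-injective (start k<s₁)  (inner _)      eq = ⊥-elim (<⇒≢+ k<s₁ eq)
  slot-injective (start k<s₁)  (end _)        eq = ⊥-elim (<⇒≢+ k<s₁ eq)
  slot-injective (inner _)     (start k<s₁)   eq = ⊥-elim (<⇒≢+ k<s₁ (sym eq))
  slot-injective (end _)       (start k<s₁)   eq = ⊥-elim (<⇒≢+ k<s₁ (sym eq))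
  slot-injective (inner {j} _) (inner {j′} _) eq =
    cong suc (+-cancelʳ-≡ 0 j j′ (+-cancelˡ-≡ s₁ _ _ eq)) , refl
  slot-injective (inner j<t)   (end _)        eq = ⊥-elim (<⇒≢+ (j+0<t j<t) (+-cancelˡ-≡ s₁ _ _ eq))
  slot-injective (end _)       (inner j<t)    eq = ⊥-elim (<⇒≢+ (j+0<t j<t) (+-cancelˡ-≡ s₁ _ _ (sym eq)))
  slot-injective {t} (end _)   (end _)        eq = refl , +-cancelˡ-≡ t _ _ (+-cancelˡ-≡ s₁ _ _ eq)

  nearRainbowBroom-fromLayout :
    ∀ {n m} (T : Collection n m) t (W : List (Fin n)) (C : List (Fin m)) {d c} →
    Unique W → length W ≡ s₁ + (t + s₂) → Unique C → length C ≡ suc t →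
    (∀ {i k k′} → Layer t i k → Layer t (suc i) k′ →
       Arc (T (lookupOr c C i)) (lookupOr d W (slot i k)) (lookupOr d W (slot (suc i) k′))) →
    ContainsNearRainbowBroom T (suc t) (forwardPath (suc t)) s₁ s₂
  nearRainbowBroom-fromLayout {n} {m} T t W C {d} {c} W! W-length C! C-length arcs =
    f , φ , f-injective , φ-arcs , startColour , endColour , rainbow
    where
    f : BroomVertex (suc t) s₁ s₂ → Fin n
    f (j , k) = lookupOr d W (slot (toℕ j) (toℕ k))

    φ : BroomArc (suc t) s₁ s₂ → Fin m
    φ (i , _) = lookupOr c C (toℕ i)

    layerOf : ∀ ((j , k) : BroomVertex (suc t) s₁ s₂) → Layer t (toℕ j) (toℕ k)
    layerOf (j , k) = layer (≤-pred (toℕ<n j)) (toℕ<n k)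

    slot<W : ∀ x → slot (toℕ (proj₁ x)) (toℕ (proj₂ x)) < length W
    slot<W x = subst (_ <_) (sym W-length) (slot-< (layerOf x))

    f-injective : ∀ x y → f x ≡ f y → x ≡ y
    f-injective x@(j , k) y@(j′ , k′) fx≡fy
      with slot-injective (layerOf x) (layerOf y) (lookupOr-injective W! (slot<W x) (slot<W y) fx≡fy)
    ... | j≡j′ , k≡k′ with refl ← toℕ-injective {i = j} {j′} j≡j′ = cong (j ,_) (toℕ-injective k≡k′)

    φ-arcs : ∀ e → Arc (T (φ e)) (tailOf (forwardPath (suc t)) f e) (headOf (forwardPath (suc t)) f e)
    φ-arcs (i , a , b) =
      subst (λ p → Arc (T (φ (i , a , b))) (lookupOr d W (slot p (toℕ a))) (f (fsuc i , b)))
            (sym (toℕ-inject₁ i))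
            (arcs (layer (<⇒≤ (toℕ<n i)) a<) (layerOf (fsuc i , b)))
      where
      a< : toℕ a < width (suc t) (toℕ i)
      a< = subst (λ p → toℕ a < width (suc t) p) (toℕ-inject₁ i) (toℕ<n a)

    startColour : ∀ e e′ → IsStartTipArc e → IsStartTipArc e′ → φ e ≡ φ e′
    startColour (i , _) (i′ , _) i≡0 i′≡0 = cong (lookupOr c C) (≡.trans i≡0 (sym i′≡0))

    endColour : ∀ e e′ → IsEndTipArc e → IsEndTipArc e′ → φ e ≡ φ e′
    endColour (i , _) (i′ , _) i≡t i′≡t = cong (lookupOr c C) (suc-injective (≡.trans i≡t (sym i′≡t)))

    rainbow : ∀ (σ : BroomPath (suc t) s₁ s₂) i j → φ (pathArc σ i) ≡ φ (pathArc σ j) → i ≡ j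
    rainbow _ i j φi≡φj = toℕ-injective (lookupOr-injective C! (toℕ<C i) (toℕ<C j) φi≡φj)
      where
      toℕ<C : ∀ (i : Fin (suc t)) → toℕ i < length C
      toℕ<C i = subst (toℕ i <_) (sym C-length) (toℕ<n i)

initialBound : ℕ → ℕ → ℕ
initialBound s₁ s₂ = bicliqueBound s₁ (starBound s₂)

extensionBound : ℕ → ℕ → ℕ
extensionBound s₁ s₂ = starBound s₁ + (starBound s₂ + starBound s₂)

-- initialBound vertices seed the construction. Growing a broom with ℓ arcs to ℓ + 1 arcs needs
-- extensionBound vertices besides its s₁ + s₂ + ℓ − 1 ones and two colours besides its ℓ ones.
broomBound : ℕ → ℕ → ℕ
broomBound s₁ s₂ = suc (initialBound s₁ s₂ + (extensionBound s₁ s₂ + (s₁ + s₂)))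

initialBound<broomBound : ∀ s₁ s₂ → initialBound s₁ s₂ < broomBound s₁ s₂
initialBound<broomBound s₁ s₂ = s≤s (m≤m+n _ _)

extensionBound<broomBound : ∀ s₁ s₂ → extensionBound s₁ s₂ + (s₁ + s₂) < broomBound s₁ s₂
extensionBound<broomBound s₁ s₂ = s≤s (m≤n+m _ (initialBound s₁ s₂))

module Construction {n m : ℕ} (T : Collection n m) (s₁ s₂ : ℕ) where

  open Layout s₁ s₂

  -- A near-rainbow broom whose path has t + 2 arcs: starts ⟶ first in startColour, the spine
  -- path from first to last in spineColours, and last ⟶ ends in endColour.
  record Broom (t : ℕ) : Set where
    field
      starts          : List (Fin n)
      first           : Fin n
      spine           : List (Fin n)
      last            : Fin n
      ends            : List (Fin n)
      startColour     : Fin m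
      spineColours    : List (Fin m)
      endColour       : Fin m
      path            : Path T first last spine spineColours
      starts-length   : length starts ≡ s₁
      spine-length    : length spineColours ≡ t
      ends-length     : length ends ≡ s₂
      starts⟶first    : All (λ u → Arc (T startColour) u first) starts
      last⟶ends       : All (Arc (T endColour) last) ends
      vertices-unique : Unique (starts ++ spine ++ ends)
      colours-unique  : Unique (startColour ∷ endColour ∷ spineColours)

    vertices : List (Fin n)
    vertices = starts ++ spine ++ ends

    colours : List (Fin m)
    colours = startColour ∷ endColour ∷ spineColours

    spine-vertices-length : length spine ≡ suc t
    spine-vertices-length = ≡.trans (Path-length T path) (cong suc spine-length)

    vertices-length : length vertices ≡ s₁ + (suc t + s₂)
    vertices-length = begin
      length (starts ++ spine ++ ends)               ≡⟨ length-++ starts ⟩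
      length starts + length (spine ++ ends)         ≡⟨ cong (length starts +_) (length-++ spine) ⟩
      length starts + (length spine + length ends)   ≡⟨ cong₂ _+_ starts-length
                                                          (cong₂ _+_ spine-vertices-length ends-length) ⟩
      s₁ + (suc t + s₂)                              ∎
      where open ≡-Reasoning

    first∈ : first ∈ vertices
    first∈ = ∈-++⁺ʳ starts (∈-++⁺ˡ (Path-first∈ T path))

    last∈ : last ∈ vertices
    last∈ = ∈-++⁺ʳ starts (∈-++⁺ˡ (Path-last∈ T path))

  module Moves {t} (β : Broom t) {c₁ c₂ : Fin m} (c₁≢c₂ : c₁ ≢ c₂)
               (c₁∉ : c₁ ∉ Broom.colours β) (c₂∉ : c₂ ∉ Broom.colours β) where
    open Broom β

    prepend : ∀ {L} → (∀ {x} → x ∈ L → x ∉ vertices) → All (λ u → Arc (T c₁) u first) L →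
              OutStar (reverse (T c₂)) s₁ L → Broom (suc t)
    prepend L-unused L⟶first star = record
      { starts          = leaves
      ; first           = centre
      ; spine           = centre ∷ spine
      ; last            = last
      ; ends            = ends
      ; startColour     = c₂
      ; spineColours    = c₁ ∷ spineColours
      ; endColour       = endColour
      ; path            = cons c₁ (All.lookup L⟶first centre∈) path
      ; starts-length   = leaves-length
      ; spine-length    = cong suc spine-length
      ; ends-length     = ends-length
      ; starts⟶first    = centre⟶leaves
      ; last⟶ends       = last⟶ends
      ; vertices-unique = Unique.++⁺ leaves-unique
                            (Unique-∷ centre∉ (Unique-++⁻ʳ starts vertices-unique)) disjoint
      ; colours-unique  = Unique-exchange c₁≢c₂ c₁∉ c₂∉ refl colours↭ colours-unique
      }
      where
      open OutStar star
      centre∉ : centre ∉ spine ++ ends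
      centre∉ = L-unused centre∈ ∘ ∈-++⁺ʳ starts
      colours↭ : c₂ ∷ endColour ∷ c₁ ∷ spineColours ↭ c₁ ∷ c₂ ∷ endColour ∷ spineColours
      colours↭ = trans (prep c₂ (swap endColour c₁ refl)) (swap c₂ c₁ refl)
      disjoint : Disjoint leaves (centre ∷ spine ++ ends)
      disjoint (x∈leaves , here refl)  = source∉targets (reverse (T c₂)) centre⟶leaves x∈leaves
      disjoint (x∈leaves , there x∈)   = L-unused (leaves⊆ x∈leaves) (∈-++⁺ʳ starts x∈)

    append : ∀ {L} → (∀ {x} → x ∈ L → x ∉ vertices) → All (Arc (T c₁) last) L →
             OutStar (T c₂) s₂ L → Broom (suc t)
    append L-unused last⟶L star = record
      { starts          = starts
      ; first           = first
      ; spine           = spine ++ [ centre ]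
      ; last            = centre
      ; ends            = leaves
      ; startColour     = startColour
      ; spineColours    = spineColours ++ [ c₁ ]
      ; endColour       = c₂
      ; path            = Path-snoc T path (All.lookup last⟶L centre∈)
      ; starts-length   = starts-length
      ; spine-length    = ≡.trans (length-∷ʳ spineColours) (cong suc spine-length)
      ; ends-length     = leaves-length
      ; starts⟶first    = starts⟶first
      ; last⟶ends       = centre⟶leaves
      ; vertices-unique = subst Unique reassociate
                            (Unique.++⁺ prefix-unique
                                        (Unique-∷ (source∉targets (T c₂) centre⟶leaves) leaves-unique)
                                        disjoint)
      ; colours-unique  = Unique-exchange c₁≢c₂ c₁∉ c₂∉ (swap startColour endColour refl) colours↭
                            colours-unique
      }
      where
      open OutStar star
      reassociate : (starts ++ spine) ++ centre ∷ leaves ≡ starts ++ (spine ++ [ centre ]) ++ leaves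
      reassociate = ≡.trans (++-assoc starts spine (centre ∷ leaves))
                            (cong (starts ++_) (sym (++-assoc spine [ centre ] leaves)))
      prefix-unique : Unique (starts ++ spine)
      prefix-unique = Unique-++⁻ˡ (starts ++ spine)
                        (subst Unique (sym (++-assoc starts spine ends)) vertices-unique)
      colours↭ : startColour ∷ c₂ ∷ spineColours ++ [ c₁ ] ↭ c₁ ∷ c₂ ∷ startColour ∷ spineColours
      colours↭ = trans (++-comm (startColour ∷ c₂ ∷ spineColours) [ c₁ ])
                       (prep c₁ (swap startColour c₂ refl))
      prefix⊆vertices : starts ++ spine ⊆ vertices
      prefix⊆vertices = subst (_ ∈_) (++-assoc starts spine ends) ∘ ∈-++⁺ˡ
      disjoint : Disjoint (starts ++ spine) (centre ∷ leaves)
      disjoint (x∈ , here refl)        = L-unused centre∈ (prefix⊆vertices x∈)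
      disjoint (x∈ , there x∈leaves)   = L-unused (leaves⊆ x∈leaves) (prefix⊆vertices x∈)

    insert : ∀ {v} → v ∉ vertices → Arc (T c₁) first v → Arc (T c₁) v last → Arc (T c₂) v last →
             Broom (suc t)
    insert {v} v-unused first⟶v v⟶last₁ v⟶last₂ = record
      { starts          = starts
      ; first           = first
      ; spine           = spine′
      ; last            = last
      ; ends            = ends
      ; startColour     = startColour
      ; spineColours    = spineColours′
      ; endColour       = endColour
      ; path            = path′
      ; starts-length   = starts-length
      ; spine-length    = ≡.trans (↭-length colours↭) (cong suc (≡.trans (sym (↭-length cs↭)) spine-length))
      ; ends-length     = ends-length
      ; starts⟶first    = starts⟶first
      ; last⟶ends       = last⟶ends
      ; vertices-unique = Unique-resp-↭ (↭-sym new-vertices↭) (Unique-∷ v-unused vertices-unique)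
      ; colours-unique  = Unique-exchange c₁≢c₂ c₁∉ c₂∉ old-colours↭ new-colours↭ colours-unique
      }
      where
      open Splice (splice T path (v-unused ∘ ∈-++⁺ʳ starts ∘ ∈-++⁺ˡ) first⟶v v⟶last₁ v⟶last₂)
        renaming (vertices to spine′; colours to spineColours′; path to path′)
      tips = startColour ∷ endColour ∷ []
      new-vertices↭ : starts ++ spine′ ++ ends ↭ v ∷ starts ++ spine ++ ends
      new-vertices↭ = trans (++⁺ˡ starts (++⁺ʳ ends vertices↭)) (shift v starts (spine ++ ends))
      old-colours↭ : tips ++ spineColours ↭ dropped ∷ tips ++ kept
      old-colours↭ = trans (++⁺ˡ tips cs↭) (shift dropped tips kept)
      new-colours↭ : tips ++ spineColours′ ↭ c₁ ∷ c₂ ∷ tips ++ kept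
      new-colours↭ = trans (++⁺ˡ tips colours↭) (shifts tips (c₁ ∷ c₂ ∷ []))

  module Growth {t} (β : Broom t) {c₁ c₂ : Fin m} (c₁≢c₂ : c₁ ≢ c₂)
                (c₁∉ : c₁ ∉ Broom.colours β) (c₂∉ : c₂ ∉ Broom.colours β)
                (room : extensionBound s₁ s₂ + length (Broom.vertices β) ≤ n) where
    open Broom β
    open Moves β c₁≢c₂ c₁∉ c₂∉

    R I R₁ J₁ R₂ J₂ R₃ : List (Fin n)
    R  = outside vertices
    I  = filter (λ r → Arc? (T c₁) r first) R
    R₁ = filter (∁? (λ r → Arc? (T c₁) r first)) R
    J₁ = filter (Arc? (T c₁) last) R₁
    R₂ = filter (∁? (Arc? (T c₁) last)) R₁
    J₂ = filter (Arc? (T c₂) last) R₂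
    R₃ = filter (∁? (Arc? (T c₂) last)) R₂

    R! : Unique R
    R! = outside-unique vertices

    R₁! : Unique R₁
    R₁! = Unique.filter⁺ _ R!

    R₂! : Unique R₂
    R₂! = Unique.filter⁺ _ R₁!

    R-unused : ∀ {x} → x ∈ R → x ∉ vertices
    R-unused = ∈-outside⁻ vertices

    R₁⊆R : R₁ ⊆ R
    R₁⊆R = filter-⊆ _ R

    R₂⊆R₁ : R₂ ⊆ R₁
    R₂⊆R₁ = filter-⊆ _ R₁

    length-R : length R ≡ length I + (length J₁ + length J₂) + length R₃
    length-R = begin
      length R                                          ≡⟨ length-filter-∁ _ R ⟨
      length I + length R₁                              ≡⟨ cong (length I +_) (length-filter-∁ _ R₁) ⟨
      length I + (length J₁ + length R₂)                ≡⟨ cong (λ x → length I + (length J₁ + x))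
                                                                (length-filter-∁ _ R₂) ⟨
      length I + (length J₁ + (length J₂ + length R₃))  ≡⟨ cong (length I +_) (+-assoc (length J₁) _ _) ⟨
      length I + (length J₁ + length J₂ + length R₃)    ≡⟨ +-assoc (length I) _ _ ⟨
      length I + (length J₁ + length J₂) + length R₃    ∎
      where open ≡-Reasoning

    R₃-nonempty : length I < starBound s₁ → length J₁ < starBound s₂ → length J₂ < starBound s₂ →
                  0 < length R₃
    R₃-nonempty I< J₁< J₂< = +-cancelˡ-< IJ 0 (length R₃) (begin-strict
      IJ + 0                ≡⟨ +-identityʳ IJ ⟩
      IJ                    <⟨ +-mono-< I< (+-mono-< J₁< J₂<) ⟩
      extensionBound s₁ s₂  ≤⟨ outside-length-≥ vertices room ⟩
      length R              ≡⟨ length-R ⟩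
      IJ + length R₃        ∎)
      where
      open ≤-Reasoning
      IJ = length I + (length J₁ + length J₂)

    insertFrom : ∀ {v} → v ∈ R₃ → Broom (suc t)
    insertFrom v∈R₃ with ∈-filter⁻ (∁? (Arc? (T c₂) last)) {xs = R₂} v∈R₃
    ... | v∈R₂ , last↛₂v with ∈-filter⁻ (∁? (Arc? (T c₁) last)) {xs = R₁} v∈R₂
    ... | v∈R₁ , last↛₁v with ∈-filter⁻ (∁? (λ r → Arc? (T c₁) r first)) {xs = R} v∈R₁
    ... | v∈R , v↛₁first = insert v-unused
      (¬Arc⇒Arc (T c₁) (∈∧∉⇒≢ first∈ v-unused) v↛₁first)
      (¬Arc⇒Arc (T c₁) (≢-sym (∈∧∉⇒≢ last∈ v-unused)) last↛₁v)
      (¬Arc⇒Arc (T c₂) (≢-sym (∈∧∉⇒≢ last∈ v-unused)) last↛₂v)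
      where v-unused = R-unused v∈R

    grow : Broom (suc t)
    grow with starBound s₁ ≤? length I
    ... | yes I-large = prepend (R-unused ∘ filter-⊆ _ R) (all-filter _ R)
                          (outStar (reverse (T c₂)) s₁ I (Unique.filter⁺ _ R!) I-large)
    ... | no I-small with starBound s₂ ≤? length J₁
    ...   | yes J₁-large = append (R-unused ∘ R₁⊆R ∘ filter-⊆ _ R₁) (all-filter _ R₁)
                             (outStar (T c₂) s₂ J₁ (Unique.filter⁺ _ R₁!) J₁-large)
    ...   | no J₁-small with starBound s₂ ≤? length J₂
    ...     | yes J₂-large = Moves.append β (≢-sym c₁≢c₂) c₂∉ c₁∉
                               (R-unused ∘ R₁⊆R ∘ R₂⊆R₁ ∘ filter-⊆ _ R₂) (all-filter _ R₂)
                               (outStar (T c₁) s₂ J₂ (Unique.filter⁺ _ R₂!) J₂-large)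
    ...     | no J₂-small = insertFrom (proj₂ (0<length⇒∃∈ R₃
                              (R₃-nonempty (≰⇒> I-small) (≰⇒> J₁-small) (≰⇒> J₂-small))))

  extend : ∀ {t} (β : Broom t) → extensionBound s₁ s₂ + length (Broom.vertices β) ≤ n →
           2 + length (Broom.colours β) ≤ m → Broom (suc t)
  extend β room palette
    with distinctPair (outside-unique (Broom.colours β)) (outside-length-≥ (Broom.colours β) palette)
  ... | c₁ , c₂ , c₁∈ , c₂∈ , c₁≢c₂ =
    Growth.grow β c₁≢c₂ (∈-outside⁻ _ c₁∈) (∈-outside⁻ _ c₂∈) room

  initial : initialBound s₁ s₂ ≤ n → 2 ≤ m → Broom 0
  initial room palette
    with distinctPair (Unique.allFin⁺ m) (subst (2 ≤_) (sym (length-tabulate (λ c → c))) palette)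
  ... | c₁ , c₂ , _ , _ , c₁≢c₂ = record
    { starts          = sources
    ; first           = centre
    ; spine           = [ centre ]
    ; last            = centre
    ; ends            = leaves
    ; startColour     = c₁
    ; spineColours    = []
    ; endColour       = c₂
    ; path            = nil
    ; starts-length   = sources-length
    ; spine-length    = refl
    ; ends-length     = leaves-length
    ; starts⟶first    = All.map (λ u⟶targets → All.lookup u⟶targets centre∈) sources⟶targets
    ; last⟶ends       = centre⟶leaves
    ; vertices-unique = Unique.++⁺ sources-unique
                          (Unique-∷ (source∉targets (T c₂) centre⟶leaves) leaves-unique) disjoint
    ; colours-unique  = (c₁≢c₂ ∷ []) ∷ [] ∷ []
    }
    where
    open OutBiclique (outBiclique (T c₁) s₁ (starBound s₂) (allFin n) (Unique.allFin⁺ n)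
                        (subst (initialBound s₁ s₂ ≤_) (sym (length-tabulate (λ x → x))) room))
    open OutStar (outStar (T c₂) s₂ targets targets-unique (≤-reflexive (sym targets-length)))
    disjoint : Disjoint sources (centre ∷ leaves)
    disjoint (x∈sources , x∈) = source∉targets (T c₁) (All.lookup sources⟶targets x∈sources) (⊆targets x∈)
      where
      ⊆targets : centre ∷ leaves ⊆ targets
      ⊆targets (here refl)     = centre∈
      ⊆targets (there x∈leaves) = leaves⊆ x∈leaves

  build : ∀ t → initialBound s₁ s₂ ≤ n → extensionBound s₁ s₂ + (s₁ + (t + s₂)) ≤ n → 3 + t ≤ m → Broom t
  build zero    init-room _    palette = initial init-room (≤-trans (n≤1+n 2) palette)
  build (suc t) init-room room palette =
    extend β (subst (λ x → extensionBound s₁ s₂ + x ≤ n) (sym (Broom.vertices-length β)) room)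
             (subst (λ x → 2 + x ≤ m) (sym (cong (λ x → 2 + x) (Broom.spine-length β))) palette)
    where
    β : Broom t
    β = build t init-room
          (≤-trans (+-monoʳ-≤ (extensionBound s₁ s₂) (+-monoʳ-≤ s₁ (+-monoˡ-≤ s₂ (n≤1+n t)))) room)
          (≤-trans (n≤1+n _) palette)

  fromBroom : ∀ {t} → Broom t → ContainsNearRainbowBroom T (suc (suc t)) (forwardPath (suc (suc t))) s₁ s₂
  fromBroom {t} β = nearRainbowBroom-fromLayout T (suc t) vertices C {first} {startColour}
                      vertices-unique vertices-length C-unique (cong suc C-length) arcs
    where
    open Broom β
    C = startColour ∷ spineColours ++ [ endColour ]

    C-unique : Unique C
    C-unique = Unique-resp-↭ (prep startColour (++-comm [ endColour ] spineColours)) colours-unique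

    C-length : length (spineColours ++ [ endColour ]) ≡ suc t
    C-length = ≡.trans (length-∷ʳ spineColours) (cong suc spine-length)

    k<starts : ∀ {k} → k < s₁ → k < length starts
    k<starts = subst (_ <_) (sym starts-length)

    at-rest : ∀ x → lookupOr first vertices (s₁ + x) ≡ lookupOr first (spine ++ ends) x
    at-rest x = lookupOr-++ʳ starts x starts-length

    at-spine : ∀ {j} → j < suc t → lookupOr first vertices (s₁ + (j + 0)) ≡ lookupOr first spine j
    at-spine {j} j<t = begin
      lookupOr first vertices (s₁ + (j + 0))   ≡⟨ at-rest (j + 0) ⟩
      lookupOr first (spine ++ ends) (j + 0)   ≡⟨ cong (lookupOr first (spine ++ ends)) (+-identityʳ j) ⟩
      lookupOr first (spine ++ ends) j         ≡⟨ lookupOr-++ˡ spine j<spine ⟩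
      lookupOr first spine j                   ∎
      where
      open ≡-Reasoning
      j<spine = subst (j <_) (sym spine-vertices-length) j<t

    at-ends : ∀ k → lookupOr first vertices (s₁ + (suc t + k)) ≡ lookupOr first ends k
    at-ends k = ≡.trans (at-rest (suc t + k)) (lookupOr-++ʳ spine k spine-vertices-length)

    spine-last : lookupOr first spine t ≡ last
    spine-last = subst (λ i → lookupOr first spine i ≡ last) spine-length (Path-last T first path)

    colour-last : lookupOr startColour (spineColours ++ [ endColour ]) t ≡ endColour
    colour-last = subst (λ i → lookupOr startColour (spineColours ++ [ endColour ]) i ≡ endColour)
                        (+-identityʳ t) (lookupOr-++ʳ spineColours 0 spine-length)

    arcs : ∀ {i k k′} → Layer (suc t) i k → Layer (suc t) (suc i) k′ →
           Arc (T (lookupOr startColour C i))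
               (lookupOr first vertices (slot i k)) (lookupOr first vertices (slot (suc i) k′))
    arcs (start k<s₁) (inner 0<t) =
      subst-Arc T refl (sym (lookupOr-++ˡ starts (k<starts k<s₁)))
                       (sym (≡.trans (at-spine 0<t) (Path-head T first path)))
        (All.lookup starts⟶first (lookupOr-∈ starts (k<starts k<s₁)))
    arcs (inner {j} j<t) (inner j+1<t) =
      subst-Arc T (sym (lookupOr-++ˡ spineColours j<length)) (sym (at-spine j<t)) (sym (at-spine j+1<t))
        (Path-arc T first startColour path j<length)
      where
      j<length : j < length spineColours
      j<length = subst (j <_) (sym spine-length) (≤-pred j+1<t)
    arcs (inner j<t) (end k<s₂) =
      subst-Arc T (sym colour-last) (sym (≡.trans (at-spine j<t) spine-last)) (sym (at-ends _))
        (All.lookup last⟶ends (lookupOr-∈ ends (subst (_ <_) (sym ends-length) k<s₂)))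
    arcs (end _) (inner j<t) = ⊥-elim (<-asym j<t (n<1+n _))

  fromBiclique : ∀ {c L} → Fin n → OutBiclique (T c) s₁ s₂ L →
                 ContainsNearRainbowBroom T 1 (forwardPath 1) s₁ s₂
  fromBiclique {c} d biclique = nearRainbowBroom-fromLayout T 0 (sources ++ targets) [ c ] {d} {c}
    (Unique.++⁺ sources-unique targets-unique disjoint)
    (≡.trans (length-++ sources) (cong₂ _+_ sources-length targets-length))
    ([] ∷ []) refl arcs
    where
    open OutBiclique biclique
    disjoint : Disjoint sources targets
    disjoint (x∈sources , x∈targets) = source∉targets (T c) (All.lookup sources⟶targets x∈sources) x∈targets
    arcs : ∀ {i k k′} → Layer 0 i k → Layer 0 (suc i) k′ →
           Arc (T (lookupOr c [ c ] i))
               (lookupOr d (sources ++ targets) (slot i k))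
               (lookupOr d (sources ++ targets) (slot (suc i) k′))
    arcs (start k<s₁) (end k′<s₂) =
      subst-Arc T refl (sym (lookupOr-++ˡ sources k<sources)) (sym (lookupOr-++ʳ sources _ sources-length))
        (All.lookup (All.lookup sources⟶targets (lookupOr-∈ sources k<sources))
                    (lookupOr-∈ targets (subst (_ <_) (sym targets-length) k′<s₂)))
      where
      k<sources = subst (_ <_) (sym sources-length) k<s₁
    arcs (start _) (inner ())

  forwardBroom : ∀ ℓ → 1 ≤ ℓ → ℓ + broomBound s₁ s₂ ≤ n → ℓ + broomBound s₁ s₂ ≤ m →
                 ContainsNearRainbowBroom T ℓ (forwardPath ℓ) s₁ s₂
  forwardBroom 1 _ room palette =
    fromBiclique (fromℕ< (<-≤-trans (s≤s z≤n) room))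
      (outBiclique (T (fromℕ< (<-≤-trans (s≤s z≤n) palette))) s₁ s₂ (allFin n) (Unique.allFin⁺ n)
        (subst (bicliqueBound s₁ s₂ ≤_) (sym (length-tabulate (λ x → x))) (begin
          bicliqueBound s₁ s₂    ≤⟨ bicliqueBound-monoʳ s₁ (k≤starBound s₂) ⟩
          initialBound s₁ s₂     <⟨ initialBound<broomBound s₁ s₂ ⟩
          broomBound s₁ s₂       <⟨ n<1+n _ ⟩
          1 + broomBound s₁ s₂   ≤⟨ room ⟩
          n                      ∎)))
    where open ≤-Reasoning
  forwardBroom (suc (suc t)) _ room palette = fromBroom (build t init-room ext-room colour-room)
    where
    open ≤-Reasoning
    ℓ  = suc (suc t)
    k₀ = broomBound s₁ s₂
    K  = extensionBound s₁ s₂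

    init-room : initialBound s₁ s₂ ≤ n
    init-room = begin
      initialBound s₁ s₂  <⟨ initialBound<broomBound s₁ s₂ ⟩
      k₀                  ≤⟨ m≤n+m k₀ ℓ ⟩
      ℓ + k₀              ≤⟨ room ⟩
      n                   ∎

    ext-room : K + (s₁ + (t + s₂)) ≤ n
    ext-room = begin
      K + (s₁ + (t + s₂))  ≡⟨ cong (K +_) (x∙yz≈y∙xz s₁ t s₂) ⟩
      K + (t + (s₁ + s₂))  ≡⟨ x∙yz≈y∙xz K t (s₁ + s₂) ⟩
      t + (K + (s₁ + s₂))  ≤⟨ +-mono-≤ (m≤n+m t 2) (<⇒≤ (extensionBound<broomBound s₁ s₂)) ⟩
      ℓ + k₀               ≤⟨ room ⟩
      n                    ∎

    colour-room : 3 + t ≤ m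
    colour-room = begin
      suc ℓ    ≡⟨ +-comm 1 ℓ ⟩
      ℓ + 1    ≤⟨ +-monoʳ-≤ ℓ (s≤s z≤n) ⟩
      ℓ + k₀   ≤⟨ palette ⟩
      m        ∎

reverseCollection : ∀ {n m} → Collection n m → Collection n m
reverseCollection T c = reverse (T c)

reverse-forward⇒backward : ∀ {n m} (T : Collection n m) {ℓ s₁ s₂} →
  ContainsNearRainbowBroom (reverseCollection T) ℓ (forwardPath ℓ) s₁ s₂ →
  ContainsNearRainbowBroom T ℓ (backwardPath ℓ) s₁ s₂
reverse-forward⇒backward T (f , φ , f-injective , arcs , startColour , endColour , rainbow) =
  f , φ , f-injective , (λ { (i , a , b) → arcs (i , a , b) }) , startColour , endColour , rainbow

nearRainbowBroom : ∀ s₁ s₂ ℓ → 1 ≤ ℓ → ∀ {n m} (T : Collection n m) →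
                   ℓ + broomBound s₁ s₂ ≤ n → ℓ + broomBound s₁ s₂ ≤ m → ∀ forward →
                   ContainsNearRainbowBroom T ℓ (if forward then forwardPath ℓ else backwardPath ℓ) s₁ s₂
nearRainbowBroom s₁ s₂ ℓ 1≤ℓ T room palette true  = Construction.forwardBroom T s₁ s₂ ℓ 1≤ℓ room palette
nearRainbowBroom s₁ s₂ ℓ 1≤ℓ T room palette false =
  reverse-forward⇒backward T (Construction.forwardBroom (reverseCollection T) s₁ s₂ ℓ 1≤ℓ room palette)

lemma5p4 : ∃ λ (k₀ : ℕ) →
    ∀ (ℓ : ℕ) → 1 ≤ ℓ →
    ∀ (n m : ℕ) (T : Collection n m) →
    ℓ + k₀ ≤ n → ℓ + k₀ ≤ m →
    ∀ (forward : Bool) →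
    ContainsNearRainbowBroom T ℓ (if forward then forwardPath ℓ else backwardPath ℓ) 2 50
lemma5p4 = broomBound 2 50 , λ ℓ 1≤ℓ n m → nearRainbowBroom 2 50 ℓ 1≤ℓ
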